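{- Let $T$ be a tournament, let $u$ be a vertex of large out-degree in $T$ and $v$ a vertex of large in-degree in $T$. Then there are at least $|T|/25$ internally vertex-disjoint directed paths from $u$ to $v$ in $T$, each of length at most $3$.
   Context: A tournament has exactly one directed edge between each pair of distinct vertices; $|T|$ is its number of vertices, $d^+(w)$, $d^-(w)$ the out- and in-degree of $w$. A vertex $v$ has large out-degree in $T$ if fewer than $|T|/25$ vertices $u\in T$ satisfy $d^+(u)>d^+(v)$; it has large in-degree in $T$ if fewer than $|T|/25$ vertices $u$ satisfy $d^-(u)>d^-(v)$. The length of a path is its number of edges; paths are internally disjoint if their internal (non-end) vertices are distinct. -}

module Defs where

open import Data.Nat using (ℕ; _<_; _≤_; _*_)
open import Data.Nat.Properties using (_<?_)
open import Data.Bool using (Bool; true; false; not)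
open import Data.Fin using (Fin)
open import Data.Fin.Subset using (∣_∣)
open import Data.Vec using (tabulate)
open import Data.List using (List; []; _∷_; _++_; length)
open import Data.List.Membership.Propositional using (_∈_; _∉_)
open import Data.List.Relation.Unary.Linked using (Linked)
open import Data.List.Relation.Unary.AllPairs using (AllPairs)
open import Data.List.Relation.Unary.Unique.Propositional using (Unique)
open import Data.Product using (_×_)
open import Relation.Binary.PropositionalEquality using (_≡_; _≢_)
open import Relation.Nullary.Decidable using (⌊_⌋)

record Tournament (n : ℕ) : Set where
  field
    adj    : Fin n → Fin n → Bool
    irrefl : ∀ x → adj x x ≡ false
    anti   : ∀ x y → x ≢ y → adj x y ≡ not (adj y x)

module _ {n : ℕ} (T : Tournament n) where
  open Tournament T

  Edge : Fin n → Fin n → Set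
  Edge x y = adj x y ≡ true

  outdeg : Fin n → ℕ
  outdeg x = ∣ tabulate (adj x) ∣

  indeg : Fin n → ℕ
  indeg x = ∣ tabulate (λ y → adj y x) ∣

  LargeOut : Fin n → Set
  LargeOut v = 25 * ∣ tabulate (λ w → ⌊ outdeg v <? outdeg w ⌋) ∣ < n

  LargeIn : Fin n → Set
  LargeIn v = 25 * ∣ tabulate (λ w → ⌊ indeg v <? indeg w ⌋) ∣ < n

  IsPath : Fin n → List (Fin n) → Fin n → Set
  IsPath u mids v = Linked Edge (u ∷ mids ++ v ∷ []) × Unique (u ∷ mids ++ v ∷ [])

  -- length (number of edges) = length mids + 1 ≤ 3
  IsShortPath : Fin n → List (Fin n) → Fin n → Set
  IsShortPath u mids v = IsPath u mids v × length mids ≤ 2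

Disjoint : {n : ℕ} → List (Fin n) → List (Fin n) → Set
Disjoint p q = ∀ x → x ∈ p → x ∉ q

-- A family of paths (each given by its list of internal vertices) that are
-- pairwise different paths and pairwise internally vertex-disjoint.
InternallyDisjoint : {n : ℕ} → List (List (Fin n)) → Set
InternallyDisjoint = AllPairs (λ p q → p ≢ q × Disjoint p q)

-- Let A be the out-neighbours of u other than v, and B the in-neighbours of v that are
-- neither u nor out-neighbours of u. Each a ∈ A with a → v gives the path u a v; the other
-- vertices of A are greedily matched into B along edges a → b, each pair giving u a b v.
-- Let k be the number of paths found, the edge u → v included. Then d⁺(u) ≤ k + |S| for
-- the unmatched ("stuck") vertices S of A, and d⁻(v) ≤ k + |F| for the unmatched ("free")
-- vertices F of B. A free vertex beats u and, by maximality of the matching, all of S, so a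
-- free vertex with at least k out-neighbours in F has larger out-degree than u: there are
-- fewer than n/25 of those. The remaining free vertices form a subtournament with all
-- out-degrees below k, hence number at most 2k. So d⁻(v) < 3k + n/25, while at most
-- 2d⁻(v) + 1 vertices have in-degree at most d⁻(v) and fewer than n/25 have more; this
-- forces n ≤ 25k.

module Submission where

open import Defs
open import Data.Bool using (Bool; true; false; not; _∧_; _∨_)
open import Data.Bool.Properties as Bool using (∧-conicalˡ; ∧-conicalʳ)
open import Data.Fin using (Fin; zero; suc)
open import Data.Fin.Properties using (_≟_; any?)
open import Data.Fin.Subset using (∣_∣)
open import Data.List using (List; []; _∷_; [_]; _++_; length; map; filter; allFin)
open import Data.List.Properties using (length-++; length-map)
open import Data.List.Membership.Propositional using (_∈_; _∉_)
open import Data.List.Membership.Propositional.Properties using (∈-filter⁻; ∈-filter⁺; ∈-allFin)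
open import Data.List.Relation.Unary.All as All using (All; []; _∷_)
open import Data.List.Relation.Unary.All.Properties as All using (All¬⇒¬Any; ¬Any⇒All¬)
open import Data.List.Relation.Unary.AllPairs as AllPairs using (AllPairs; []; _∷_)
import Data.List.Relation.Unary.AllPairs.Properties as AllPairs
open import Data.List.Relation.Unary.Any using (here; there)
open import Data.List.Relation.Unary.Linked using ([-]; _∷_)
open import Data.List.Relation.Unary.Unique.Propositional using (Unique)
open import Data.List.Relation.Unary.Unique.Propositional.Properties as Unique using (allFin⁺)
open import Data.Nat using (ℕ; zero; suc; _+_; _*_; _≤_; _<_; z≤n; s≤s; s≤s⁻¹; _<?_; _≤?_)
open import Data.Nat.Properties hiding (_≟_)
open import Algebra.Properties.Semiring.Sum +-*-semiring
  using (sum; sum-cong-≗; sum-replicate-zero; ∑-distrib-+; ∑-comm; *-distribˡ-sum; *-distribʳ-sum)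
open import Data.Nat.Tactic.RingSolver using (solve-∀)
open import Data.Product using (Σ; _×_; _,_; proj₁; proj₂)
open import Data.Product.Relation.Binary.Pointwise.NonDependent using (Pointwise)
open import Data.Vec using (tabulate)
open import Function using (_∘_)
open import Relation.Binary.PropositionalEquality
  using (_≡_; _≢_; refl; sym; trans; cong; cong₂; subst; module ≡-Reasoning)
open import Relation.Nullary using (¬_; ¬?; Dec; yes; no; contradiction)
open import Relation.Nullary.Decidable
  using (does; ⌊_⌋; _×-dec_; decidable-stable; dec-true; isYes≗does)

𝟙 : Bool → ℕ
𝟙 true  = 1
𝟙 false = 0

∧-intro : ∀ {a b} → a ≡ true → b ≡ true → a ∧ b ≡ true
∧-intro refl refl = refl

∧-elim : ∀ {a b} → a ∧ b ≡ true → a ≡ true × b ≡ true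
∧-elim {true} {true} _ = refl , refl

not-elim : ∀ {b} → not b ≡ true → b ≡ false
not-elim {false} _ = refl

does-elim : ∀ {P : Set} (p? : Dec P) → does p? ≡ true → P
does-elim (yes p) _ = p

not-does-elim : ∀ {P : Set} (p? : Dec P) → not (does p?) ≡ true → ¬ P
not-does-elim (no ¬p) _ = ¬p

not-does-intro : ∀ {P : Set} (p? : Dec P) → ¬ P → not (does p?) ≡ true
not-does-intro (yes p) ¬p = contradiction p ¬p
not-does-intro (no _)  _  = refl

separated : ∀ {A : Set} (f : A → Bool) {x y} → f x ≡ true → f y ≡ false → x ≢ y
separated f fx fy refl = contradiction (trans (sym fx) fy) λ ()

-- Counting subsets of Fin n

count : ∀ {n} → (Fin n → Bool) → ℕ
count P = sum (𝟙 ∘ P)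

∣tabulate∣≡count : ∀ {n} (P : Fin n → Bool) → ∣ tabulate P ∣ ≡ count P
∣tabulate∣≡count {zero}  P = refl
∣tabulate∣≡count {suc n} P with P zero
... | true  = cong suc (∣tabulate∣≡count (P ∘ suc))
... | false = ∣tabulate∣≡count (P ∘ suc)

sum-mono-≤ : ∀ {n} {f g : Fin n → ℕ} → (∀ x → f x ≤ g x) → sum f ≤ sum g
sum-mono-≤ {zero}  f≤g = z≤n
sum-mono-≤ {suc n} f≤g = +-mono-≤ (f≤g zero) (sum-mono-≤ (f≤g ∘ suc))

∑-distrib-+₃ : ∀ {n} (f g h : Fin n → ℕ) → sum (λ i → f i + g i + h i) ≡ sum f + sum g + sum h
∑-distrib-+₃ f g h = trans (∑-distrib-+ (λ i → f i + g i) h) (cong (_+ sum h) (∑-distrib-+ f g))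

count-mono : ∀ {n} {P Q : Fin n → Bool} → (∀ x → P x ≡ true → Q x ≡ true) → count P ≤ count Q
count-mono {P = P} {Q} P⊆Q = sum-mono-≤ λ x → 𝟙-mono (P x) (Q x) (P⊆Q x)
  where
  𝟙-mono : ∀ p q → (p ≡ true → q ≡ true) → 𝟙 p ≤ 𝟙 q
  𝟙-mono false q   _   = z≤n
  𝟙-mono true  q p⇒q rewrite p⇒q refl = ≤-refl

count-∨ : ∀ {n} (P Q : Fin n → Bool) → count (λ x → P x ∨ Q x) ≤ count P + count Q
count-∨ P Q = ≤-trans (sum-mono-≤ λ x → 𝟙-∨ (P x) (Q x)) (≤-reflexive (∑-distrib-+ (𝟙 ∘ P) (𝟙 ∘ Q)))
  where
  𝟙-∨ : ∀ p q → 𝟙 (p ∨ q) ≤ 𝟙 p + 𝟙 q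
  𝟙-∨ true  q = s≤s z≤n
  𝟙-∨ false q = ≤-refl

count-disjoint : ∀ {n} {P Q R : Fin n → Bool} →
                 (∀ x → P x ≡ true → R x ≡ true) → (∀ x → Q x ≡ true → R x ≡ true) →
                 (∀ x → P x ≡ true → Q x ≢ true) → count P + count Q ≤ count R
count-disjoint {P = P} {Q} {R} P⊆R Q⊆R P∩Q=∅ =
  ≤-trans (≤-reflexive (sym (∑-distrib-+ (𝟙 ∘ P) (𝟙 ∘ Q))))
          (sum-mono-≤ λ x → 𝟙-disjoint (P x) (Q x) (R x) (P⊆R x) (Q⊆R x) (P∩Q=∅ x))
  where
  𝟙-disjoint : ∀ p q r → (p ≡ true → r ≡ true) → (q ≡ true → r ≡ true) →
               (p ≡ true → q ≢ true) → 𝟙 p + 𝟙 q ≤ 𝟙 r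
  𝟙-disjoint false false r _   _   _    = z≤n
  𝟙-disjoint true  false r p⇒r _   _    rewrite p⇒r refl = ≤-refl
  𝟙-disjoint false true  r _   q⇒r _    rewrite q⇒r refl = ≤-refl
  𝟙-disjoint true  true  r _   _   p⇒¬q = contradiction refl (p⇒¬q refl)

count-split : ∀ {n} (P Q : Fin n → Bool) →
              count P ≡ count (λ x → Q x ∧ P x) + count (λ x → not (Q x) ∧ P x)
count-split P Q = trans (sum-cong-≗ λ x → 𝟙-split (P x) (Q x))
                        (∑-distrib-+ (λ x → 𝟙 (Q x ∧ P x)) (λ x → 𝟙 (not (Q x) ∧ P x)))
  where
  𝟙-split : ∀ p q → 𝟙 p ≡ 𝟙 (q ∧ p) + 𝟙 (not q ∧ p)
  𝟙-split p true  = sym (+-identityʳ (𝟙 p))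
  𝟙-split p false = refl

count-complement : ∀ {n} (P : Fin n → Bool) → n ≡ count P + count (not ∘ P)
count-complement {zero}  P = refl
count-complement {suc n} P with P zero
... | true  = cong suc (count-complement (P ∘ suc))
... | false = trans (cong suc (count-complement (P ∘ suc))) (sym (+-suc _ _))

count-≟ : ∀ {n} (y : Fin n) → count (λ x → does (x ≟ y)) ≡ 1
count-≟ {suc n} zero    = cong suc (sum-replicate-zero n)
count-≟ {suc n} (suc y) = count-≟ y

count-≟∧ : ∀ {n} (y : Fin n) (P : Fin n → Bool) → count (λ x → does (x ≟ y) ∧ P x) ≡ 𝟙 (P y)
count-≟∧ {suc n} zero    P = trans (cong (𝟙 (P zero) +_) (sum-replicate-zero n)) (+-identityʳ _)
count-≟∧ {suc n} (suc y) P = count-≟∧ y (P ∘ suc)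

count-split-≟ : ∀ {n} (P : Fin n → Bool) y → count P ≡ 𝟙 (P y) + count (λ x → not (does (x ≟ y)) ∧ P x)
count-split-≟ P y = trans (count-split P (λ x → does (x ≟ y)))
                          (cong (_+ count (λ x → not (does (x ≟ y)) ∧ P x)) (count-≟∧ y P))

module _ {n : ℕ} where
  open import Data.List.Membership.DecPropositional (_≟_ {n}) using (_∈?_)

  count-∈ : (xs : List (Fin n)) → count (λ x → does (x ∈? xs)) ≤ length xs
  count-∈ []       = ≤-reflexive (sum-replicate-zero n)
  count-∈ (y ∷ ys) = begin
    count (λ x → does (x ≟ y) ∨ does (x ∈? ys))
      ≤⟨ count-∨ (λ x → does (x ≟ y)) (λ x → does (x ∈? ys)) ⟩
    count (λ x → does (x ≟ y)) + count (λ x → does (x ∈? ys))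
      ≤⟨ +-mono-≤ (≤-reflexive (count-≟ y)) (count-∈ ys) ⟩
    suc (length ys) ∎
    where open ≤-Reasoning

  count-split-∈ : ∀ P xs → count P ≤ length xs + count (λ x → not (does (x ∈? xs)) ∧ P x)
  count-split-∈ P xs = begin
    count P                                    ≡⟨ count-split P (λ x → does (x ∈? xs)) ⟩
    count (λ x → does (x ∈? xs) ∧ P x) + rest  ≤⟨ +-monoˡ-≤ rest (≤-trans ∈xs∩P≤∈xs (count-∈ xs)) ⟩
    length xs + rest                           ∎
    where
    open ≤-Reasoning
    rest = count (λ x → not (does (x ∈? xs)) ∧ P x)
    ∈xs∩P≤∈xs = count-mono {Q = λ x → does (x ∈? xs)} λ x → ∧-conicalˡ _ _

quadratic-bound : ∀ s e d → 2 * e + s ≡ s * s → e ≤ s * d → s ≤ suc (2 * d)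
quadratic-bound zero      e d _       _    = z≤n
quadratic-bound s@(suc _) e d 2e+s≡s² e≤sd = *-cancelʳ-≤ s (suc (2 * d)) s (begin
  s * s              ≡⟨ 2e+s≡s² ⟨
  2 * e + s          ≤⟨ +-monoˡ-≤ s (*-monoʳ-≤ 2 e≤sd) ⟩
  2 * (s * d) + s    ≡⟨ expand s d ⟩
  suc (2 * d) * s    ∎)
  where
  open ≤-Reasoning
  expand : ∀ s d → 2 * (s * d) + s ≡ suc (2 * d) * s
  expand = solve-∀

reverse : ∀ {n} → Tournament n → Tournament n
reverse T = record
  { adj    = λ x y → adj y x
  ; irrefl = irrefl
  ; anti   = λ x y x≢y → anti y x (x≢y ∘ sym)
  }
  where open Tournament T

module _ {n : ℕ} (T : Tournament n) where
  open Tournament T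

  edge⇒≢ : ∀ {x y} → Edge T x y → x ≢ y
  edge⇒≢ {x} x→y refl = contradiction (trans (sym x→y) (irrefl x)) λ ()

  nonEdge⇒reverseEdge : ∀ {x y} → x ≢ y → adj x y ≡ false → Edge T y x
  nonEdge⇒reverseEdge {x} {y} x≢y x↛y = trans (anti y x (x≢y ∘ sym)) (cong not x↛y)

  outdeg≡count : ∀ x → outdeg T x ≡ count (adj x)
  outdeg≡count x = ∣tabulate∣≡count (adj x)

  outdegIn : (Fin n → Bool) → Fin n → ℕ
  outdegIn S x = count (λ y → S y ∧ adj x y)

  edgesIn : (Fin n → Bool) → ℕ
  edgesIn S = sum λ x → sum λ y → 𝟙 (S x ∧ (S y ∧ adj x y))

  2*edgesIn+count≡count² : ∀ S → 2 * edgesIn S + count S ≡ count S * count S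
  2*edgesIn+count≡count² S = sym (begin
      count S * count S
    ≡⟨ *-distribʳ-sum (count S) (𝟙 ∘ S) ⟩
      sum (λ x → 𝟙 (S x) * count S)
    ≡⟨ sum-cong-≗ (λ x → *-distribˡ-sum (𝟙 (S x)) (𝟙 ∘ S)) ⟩
      sum (λ x → sum λ y → 𝟙 (S x) * 𝟙 (S y))
    ≡⟨ sum-cong-≗ (λ x → sum-cong-≗ (λ y → pair-split x y)) ⟨
      sum (λ x → sum λ y → e x y + e y x + d x y)
    ≡⟨ sum-cong-≗ (λ x → ∑-distrib-+₃ (e x) (λ y → e y x) (d x)) ⟩
      sum (λ x → sum (e x) + sum (λ y → e y x) + sum (d x))
    ≡⟨ ∑-distrib-+₃ (λ x → sum (e x)) (λ x → sum λ y → e y x) (λ x → sum (d x)) ⟩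
      edgesIn S + sum (λ x → sum λ y → e y x) + sum (λ x → sum (d x))
    ≡⟨ cong₂ (λ a b → edgesIn S + a + b) (∑-comm (λ x y → e y x)) (sum-cong-≗ (λ x → count-≟∧ x S)) ⟩
      edgesIn S + edgesIn S + count S
    ≡⟨ cong (_+ count S) (cong (edgesIn S +_) (+-identityʳ (edgesIn S))) ⟨
      2 * edgesIn S + count S
    ∎)
    where
    open ≡-Reasoning
    e d : Fin n → Fin n → ℕ
    e x y = 𝟙 (S x ∧ (S y ∧ adj x y))
    d x y = 𝟙 (does (y ≟ x) ∧ S y)
    -- Between two distinct vertices of S there is exactly one edge.
    pair-split : ∀ x y → e x y + e y x + d x y ≡ 𝟙 (S x) * 𝟙 (S y)
    pair-split x y with y ≟ x
    ... | yes refl rewrite irrefl x = diagonal (S x)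
      where
      diagonal : ∀ s → 𝟙 (s ∧ (s ∧ false)) + 𝟙 (s ∧ (s ∧ false)) + 𝟙 s ≡ 𝟙 s * 𝟙 s
      diagonal true  = refl
      diagonal false = refl
    ... | no y≢x rewrite anti y x y≢x = offDiagonal (S x) (S y) (adj x y)
      where
      offDiagonal : ∀ s t a → 𝟙 (s ∧ (t ∧ a)) + 𝟙 (t ∧ (s ∧ not a)) + 0 ≡ 𝟙 s * 𝟙 t
      offDiagonal true  true  true  = refl
      offDiagonal true  true  false = refl
      offDiagonal true  false a     = refl
      offDiagonal false true  true  = refl
      offDiagonal false true  false = refl
      offDiagonal false false a     = refl

  outdegIn≤⇒count≤ : ∀ S d → (∀ x → S x ≡ true → outdegIn S x ≤ d) → count S ≤ suc (2 * d)
  outdegIn≤⇒count≤ S d outdegIn≤d =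
    quadratic-bound (count S) (edgesIn S) d (2*edgesIn+count≡count² S) (begin
      edgesIn S                  ≤⟨ sum-mono-≤ rowSum≤ ⟩
      sum (λ x → 𝟙 (S x) * d)    ≡⟨ *-distribʳ-sum d (𝟙 ∘ S) ⟨
      count S * d                ∎)
    where
    open ≤-Reasoning
    rowSum≤ : ∀ x → sum (λ y → 𝟙 (S x ∧ (S y ∧ adj x y))) ≤ 𝟙 (S x) * d
    rowSum≤ x with S x in Sx
    ... | true  = ≤-trans (outdegIn≤d x Sx) (≤-reflexive (sym (+-identityʳ d)))
    ... | false = ≤-reflexive (sum-replicate-zero n)

  outdegIn<⇒count≤ : ∀ S t → (∀ x → S x ≡ true → outdegIn S x < t) → count S ≤ 2 * t
  outdegIn<⇒count≤ S zero    outdegIn<0 =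
    ≤-trans (count-mono {Q = λ _ → false} λ x Sx → contradiction (outdegIn<0 x Sx) λ ())
            (≤-reflexive (sum-replicate-zero n))
  outdegIn<⇒count≤ S (suc d) outdegIn≤d = begin
    count S          ≤⟨ outdegIn≤⇒count≤ S d (λ x Sx → s≤s⁻¹ (outdegIn≤d x Sx)) ⟩
    suc (2 * d)      ≤⟨ n≤1+n _ ⟩
    2 + 2 * d        ≡⟨ *-suc 2 d ⟨
    2 * suc d        ∎
    where open ≤-Reasoning

∣indeg≤d∣≤1+2d : ∀ {n} (T : Tournament n) d → count (λ w → not ⌊ d <? indeg T w ⌋) ≤ suc (2 * d)
∣indeg≤d∣≤1+2d T d = outdegIn≤⇒count≤ (reverse T) (λ w → not ⌊ d <? indeg T w ⌋) d indegIn≤d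
  where
  open Tournament T
  indegIn≤d : ∀ x → not ⌊ d <? indeg T x ⌋ ≡ true → count (λ y → not ⌊ d <? indeg T y ⌋ ∧ adj y x) ≤ d
  indegIn≤d x indeg≤d with d <? indeg T x
  ... | no d≮indeg = begin
    count (λ y → not ⌊ d <? indeg T y ⌋ ∧ adj y x)
      ≤⟨ count-mono {Q = λ y → adj y x} (λ y → ∧-conicalʳ _ _) ⟩
    count (λ y → adj y x)  ≡⟨ ∣tabulate∣≡count (λ y → adj y x) ⟨
    indeg T x              ≤⟨ ≮⇒≥ d≮indeg ⟩
    d                      ∎
    where open ≤-Reasoning

module _ {n : ℕ} (T : Tournament n) {u v : Fin n} (u≢v : u ≢ v) where

  edge-isShortPath : Edge T u v → IsShortPath T u [] v
  edge-isShortPath u→v = (u→v ∷ [-] , (u≢v ∷ []) ∷ [] ∷ []) , z≤n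

  twoEdge-isShortPath : ∀ {a} → Edge T u a → Edge T a v → IsShortPath T u [ a ] v
  twoEdge-isShortPath u→a a→v =
    (u→a ∷ a→v ∷ [-] , (edge⇒≢ T u→a ∷ u≢v ∷ []) ∷ (edge⇒≢ T a→v ∷ []) ∷ [] ∷ []) , s≤s z≤n

  threeEdge-isShortPath : ∀ {a b} → u ≢ b → a ≢ v →
                          Edge T u a → Edge T a b → Edge T b v → IsShortPath T u (a ∷ b ∷ []) v
  threeEdge-isShortPath u≢b a≢v u→a a→b b→v =
    ( u→a ∷ a→b ∷ b→v ∷ [-]
    , (edge⇒≢ T u→a ∷ u≢b ∷ u≢v ∷ [])
      ∷ (edge⇒≢ T a→b ∷ a≢v ∷ [])
      ∷ (edge⇒≢ T b→v ∷ [])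
      ∷ [] ∷ []
    ) , s≤s (s≤s z≤n)

allPairs-zipWithAll : ∀ {A : Set} {P : A → Set} {R S : A → A → Set} →
                      (∀ {x y} → P x → P y → R x y → S x y) →
                      ∀ {xs} → All P xs → AllPairs R xs → AllPairs S xs
allPairs-zipWithAll f []         []         = []
allPairs-zipWithAll f (px ∷ pxs) (rx ∷ rxs) =
  All.zipWith (λ (py , r) → f px py r) (pxs , rx) ∷ allPairs-zipWithAll f pxs rxs

module _ {n : ℕ} where

  disjoint : {p q : List (Fin n)} → All (λ x → All (x ≢_) q) p → Disjoint p q
  disjoint p∩q=∅ x x∈p = All¬⇒¬Any (All.lookup p∩q=∅ x∈p)

  disjoint⇒≢ : {p q : List (Fin n)} → p ≢ [] → Disjoint p q → p ≢ q
  disjoint⇒≢ {[]}    p≢[] _   _    = p≢[] refl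
  disjoint⇒≢ {x ∷ p} _    p∩q refl = p∩q x (here refl) (here refl)

  internallyDisjoint : {ps : List (List (Fin n))} → All (_≢ []) ps → AllPairs Disjoint ps →
                       InternallyDisjoint ps
  internallyDisjoint []             []           = []
  internallyDisjoint (p≢[] ∷ ps≢[]) (p∩ps ∷ ps!) =
    All.map (λ p∩q → disjoint⇒≢ p≢[] p∩q , p∩q) p∩ps ∷ internallyDisjoint ps≢[] ps!

  []∷-internallyDisjoint : {ps : List (List (Fin n))} → All (_≢ []) ps → InternallyDisjoint ps →
                           InternallyDisjoint ([] ∷ ps)
  []∷-internallyDisjoint ps≢[] ps! = All.map (λ q≢[] → q≢[] ∘ sym , λ _ ()) ps≢[] ∷ ps!

-- Greedy maximal matchings

module _ {n : ℕ} (E : Fin n → Fin n → Bool) where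
  open import Data.List.Membership.DecPropositional (_≟_ {n}) using (_∈?_)

  record MaximalMatching (as : List (Fin n)) : Set where
    field
      pairs    : List (Fin n × Fin n)
      lefts⊆   : All (λ ab → proj₁ ab ∈ as) pairs
      edges    : All (λ ab → E (proj₁ ab) (proj₂ ab) ≡ true) pairs
      distinct : AllPairs (Pointwise _≢_ _≢_) pairs
      maximal  : ∀ {a b} → a ∈ as → a ∉ map proj₁ pairs → E a b ≡ true → b ∈ map proj₂ pairs

  maximalMatching : ∀ as → Unique as → MaximalMatching as
  maximalMatching [] [] = record
    { pairs = [] ; lefts⊆ = [] ; edges = [] ; distinct = [] ; maximal = λ () }
  maximalMatching (a ∷ as) (a∉as ∷ as!) with maximalMatching as as!
  ... | M with any? (λ b → (E a b Bool.≟ true) ×-dec ¬? (b ∈? map proj₂ (MaximalMatching.pairs M)))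
  ... | yes (b , a→b , b∉M) = record
    { pairs    = (a , b) ∷ pairs
    ; lefts⊆   = here refl ∷ All.map there lefts⊆
    ; edges    = a→b ∷ edges
    ; distinct = All.zipWith (λ (a′∈as , b≢b′) → All.lookup a∉as a′∈as , b≢b′)
                             (lefts⊆ , All.map⁻ (¬Any⇒All¬ _ b∉M)) ∷ distinct
    ; maximal  = λ { (here refl)   a∉  _     → contradiction (here refl) a∉
                   ; (there a′∈as) a′∉ a′→b′ → there (maximal a′∈as (a′∉ ∘ there) a′→b′) }
    }
    where open MaximalMatching M
  ... | no ∄b = record
    { pairs    = pairs
    ; lefts⊆   = All.map there lefts⊆
    ; edges    = edges
    ; distinct = distinct
    ; maximal  = λ { {b = b} (here refl) _ a→b → decidable-stable (b ∈? _) (λ b∉M → ∄b (b , a→b , b∉M))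
                   ; (there a′∈as) a′∉ a′→b′ → maximal a′∈as a′∉ a′→b′ }
    }
    where open MaximalMatching M

-- The paths from u to v

module _ {n : ℕ} (T : Tournament n) (u v : Fin n) where
  open Tournament T
  open import Data.List.Membership.DecPropositional (_≟_ {n}) using (_∈?_)

  A A₁ A₂ C B : Fin n → Bool
  A  x = not (does (x ≟ v)) ∧ adj u x
  A₁ x = adj x v ∧ A x
  A₂ x = not (adj x v) ∧ A x
  C  x = not (does (x ≟ u)) ∧ adj x v
  B  x = not (adj u x) ∧ C x

  Linkable : Fin n → Fin n → Bool
  Linkable a b = A₂ a ∧ (adj a b ∧ B b)

  A₁-elim : ∀ {x} → A₁ x ≡ true → Edge T u x × Edge T x v
  A₁-elim A₁x = let x→v , Ax = ∧-elim A₁x in proj₂ (∧-elim Ax) , x→v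

  A₂-elim : ∀ {x} → A₂ x ≡ true → Edge T u x × adj x v ≡ false × x ≢ v
  A₂-elim A₂x = let x↛v , Ax = ∧-elim A₂x ; x≢v , u→x = ∧-elim Ax in
    u→x , not-elim x↛v , not-does-elim (_ ≟ v) x≢v

  B-elim : ∀ {x} → B x ≡ true → adj u x ≡ false × x ≢ u × Edge T x v
  B-elim Bx = let u↛x , Cx = ∧-elim Bx ; x≢u , x→v = ∧-elim Cx in
    not-elim u↛x , not-does-elim (_ ≟ u) x≢u , x→v

  Linkable-elim : ∀ {a b} → Linkable a b ≡ true → A₂ a ≡ true × Edge T a b × B b ≡ true
  Linkable-elim Lab = let A₂a , a→b,Bb = ∧-elim Lab ; a→b , Bb = ∧-elim a→b,Bb in A₂a , a→b , Bb

  A₂-B-separated : ∀ {a b} → A₂ a ≡ true → B b ≡ true → a ≢ b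
  A₂-B-separated A₂a Bb = separated (adj u) (proj₁ (A₂-elim A₂a)) (proj₁ (B-elim Bb))

  matching : MaximalMatching Linkable (allFin n)
  matching = maximalMatching Linkable (allFin n) (allFin⁺ n)

  open MaximalMatching matching

  lefts rights direct : List (Fin n)
  lefts  = map proj₁ pairs
  rights = map proj₂ pairs
  direct = filter (λ x → A₁ x Bool.≟ true) (allFin n)

  direct-elim : ∀ {a} → a ∈ direct → A₁ a ≡ true
  direct-elim = proj₂ ∘ ∈-filter⁻ (λ x → A₁ x Bool.≟ true) {xs = allFin n}

  edgePath : Bool → List (List (Fin n))
  edgePath true  = [ [] ]
  edgePath false = []

  pathVia : Fin n × Fin n → List (Fin n)
  pathVia (a , b) = a ∷ b ∷ []

  indirectPaths paths : List (List (Fin n))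
  indirectPaths = map [_] direct ++ map pathVia pairs
  paths         = edgePath (adj u v) ++ indirectPaths

  k : ℕ
  k = length paths

  length-paths : k ≡ 𝟙 (adj u v) + (length direct + length pairs)
  length-paths = begin
    length paths
      ≡⟨ length-++ (edgePath (adj u v)) ⟩
    length (edgePath (adj u v)) + length indirectPaths
      ≡⟨ cong₂ _+_ (length-edgePath (adj u v)) (length-++ (map [_] direct)) ⟩
    𝟙 (adj u v) + (length (map [_] direct) + length (map pathVia pairs))
      ≡⟨ cong (𝟙 (adj u v) +_) (cong₂ _+_ (length-map [_] direct) (length-map pathVia pairs)) ⟩
    𝟙 (adj u v) + (length direct + length pairs) ∎
    where
    open ≡-Reasoning
    length-edgePath : ∀ b → length (edgePath b) ≡ 𝟙 b
    length-edgePath true  = refl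
    length-edgePath false = refl

  paths-short : u ≢ v → All (λ p → IsShortPath T u p v) paths
  paths-short u≢v =
    All.++⁺ edgePath-short (All.++⁺ (All.map⁺ (All.tabulate direct-short)) (All.map⁺ (All.map pair-short edges)))
    where
    edgePath-short : All (λ p → IsShortPath T u p v) (edgePath (adj u v))
    edgePath-short with adj u v in u→v
    ... | true  = edge-isShortPath T u≢v u→v ∷ []
    ... | false = []
    direct-short : ∀ {a} → a ∈ direct → IsShortPath T u [ a ] v
    direct-short a∈direct = let u→a , a→v = A₁-elim (direct-elim a∈direct) in
      twoEdge-isShortPath T u≢v u→a a→v
    pair-short : ∀ {ab} → Linkable (proj₁ ab) (proj₂ ab) ≡ true → IsShortPath T u (pathVia ab) v
    pair-short Lab =
      let A₂a , a→b , Bb = Linkable-elim Lab ; u→a , _ , a≢v = A₂-elim A₂a ; _ , b≢u , b→v = B-elim Bb in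
      threeEdge-isShortPath T u≢v (b≢u ∘ sym) a≢v u→a a→b b→v

  indirectPaths-nonEmpty : All (_≢ []) indirectPaths
  indirectPaths-nonEmpty =
    All.++⁺ {xs = map [_] direct} (All.map⁺ (All.tabulate {xs = direct} λ _ ()))
                                  (All.map⁺ (All.tabulate {xs = pairs} λ _ ()))

  indirectPaths-internallyDisjoint : InternallyDisjoint indirectPaths
  indirectPaths-internallyDisjoint = internallyDisjoint indirectPaths-nonEmpty
    (AllPairs.++⁺ (AllPairs.map⁺ (AllPairs.map direct-direct-disjoint (Unique.filter⁺ _ (allFin⁺ n))))
                  (AllPairs.map⁺ (allPairs-zipWithAll pair-pair-disjoint edges distinct))
                  (All.map⁺ (All.tabulate λ a∈direct → All.map⁺ (All.map (direct-pair-disjoint a∈direct) edges))))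
    where
    direct-direct-disjoint : ∀ {a a′} → a ≢ a′ → Disjoint [ a ] [ a′ ]
    direct-direct-disjoint a≢a′ = disjoint ((a≢a′ ∷ []) ∷ [])
    direct-pair-disjoint : ∀ {a a′b′} → a ∈ direct → Linkable (proj₁ a′b′) (proj₂ a′b′) ≡ true →
                           Disjoint [ a ] (pathVia a′b′)
    direct-pair-disjoint a∈direct La′b′ =
      let u→a , a→v = A₁-elim (direct-elim a∈direct) ; A₂a′ , _ , Bb′ = Linkable-elim La′b′
          _ , a′↛v , _ = A₂-elim A₂a′ ; u↛b′ , _ = B-elim Bb′ in
      disjoint ((separated (λ x → adj x v) a→v a′↛v ∷ separated (adj u) u→a u↛b′ ∷ []) ∷ [])
    pair-pair-disjoint : ∀ {ab a′b′} → Linkable (proj₁ ab) (proj₂ ab) ≡ true →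
                         Linkable (proj₁ a′b′) (proj₂ a′b′) ≡ true →
                         Pointwise _≢_ _≢_ ab a′b′ → Disjoint (pathVia ab) (pathVia a′b′)
    pair-pair-disjoint Lab La′b′ (a≢a′ , b≢b′) =
      let A₂a , _ , Bb = Linkable-elim Lab ; A₂a′ , _ , Bb′ = Linkable-elim La′b′ in
      disjoint ( (a≢a′ ∷ A₂-B-separated A₂a Bb′ ∷ [])
               ∷ ((A₂-B-separated A₂a′ Bb ∘ sym) ∷ b≢b′ ∷ [])
               ∷ [])

  paths-internallyDisjoint : InternallyDisjoint paths
  paths-internallyDisjoint with adj u v
  ... | true  = []∷-internallyDisjoint indirectPaths-nonEmpty indirectPaths-internallyDisjoint
  ... | false = indirectPaths-internallyDisjoint

  Stuck Free : Fin n → Bool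
  Stuck x = not (does (x ∈? lefts)) ∧ A₂ x
  Free  y = not (does (y ∈? rights)) ∧ B y

  Stuck-elim : ∀ {x} → Stuck x ≡ true → x ∉ lefts × A₂ x ≡ true
  Stuck-elim Stuck-x = let x∉ , A₂x = ∧-elim Stuck-x in not-does-elim (_ ∈? lefts) x∉ , A₂x

  Free-elim : ∀ {y} → Free y ≡ true → y ∉ rights × B y ≡ true
  Free-elim Free-y = let y∉ , By = ∧-elim Free-y in not-does-elim (_ ∈? rights) y∉ , By

  count-A₁≤ : count A₁ ≤ length direct
  count-A₁≤ = ≤-trans (count-mono {P = A₁} {Q = λ x → does (x ∈? direct)} λ x A₁x →
                         dec-true (x ∈? direct) (∈-filter⁺ (λ x → A₁ x Bool.≟ true) (∈-allFin x) A₁x))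
                      (count-∈ direct)

  count-A₂≤ : count A₂ ≤ length pairs + count Stuck
  count-A₂≤ = subst (λ l → count A₂ ≤ l + count Stuck) (length-map proj₁ pairs) (count-split-∈ A₂ lefts)

  count-B≤ : count B ≤ length pairs + count Free
  count-B≤ = subst (λ l → count B ≤ l + count Free) (length-map proj₂ pairs) (count-split-∈ B rights)

  k-regroup : ∀ s → 𝟙 (adj u v) + (length direct + (length pairs + s)) ≡ k + s
  k-regroup s = trans (regroup (𝟙 (adj u v)) (length direct) (length pairs) s) (cong (_+ s) (sym length-paths))
    where
    regroup : ∀ b d p s → b + (d + (p + s)) ≡ b + (d + p) + s
    regroup = solve-∀

  outdeg-u≤ : count (adj u) ≤ k + count Stuck
  outdeg-u≤ = begin
    count (adj u)                                                 ≡⟨ count-split-≟ (adj u) v ⟩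
    𝟙 (adj u v) + count A                                         ≡⟨ cong (𝟙 (adj u v) +_) (count-split A (λ x → adj x v)) ⟩
    𝟙 (adj u v) + (count A₁ + count A₂)                           ≤⟨ +-monoʳ-≤ (𝟙 (adj u v)) (+-mono-≤ count-A₁≤ count-A₂≤) ⟩
    𝟙 (adj u v) + (length direct + (length pairs + count Stuck))  ≡⟨ k-regroup (count Stuck) ⟩
    k + count Stuck                                               ∎
    where open ≤-Reasoning

  indeg-v≤ : count (λ x → adj x v) ≤ k + count Free
  indeg-v≤ = begin
    count (λ x → adj x v)                                         ≡⟨ count-split-≟ (λ x → adj x v) u ⟩
    𝟙 (adj u v) + count C                                         ≡⟨ cong (𝟙 (adj u v) +_) (count-split C (adj u)) ⟩
    𝟙 (adj u v) + (count (λ x → adj u x ∧ C x) + count B)         ≤⟨ +-monoʳ-≤ (𝟙 (adj u v)) (+-mono-≤ u→C≤ count-B≤) ⟩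
    𝟙 (adj u v) + (length direct + (length pairs + count Free))   ≡⟨ k-regroup (count Free) ⟩
    k + count Free                                                ∎
    where
    open ≤-Reasoning
    u→C⊆A₁ : ∀ x → adj u x ∧ C x ≡ true → A₁ x ≡ true
    u→C⊆A₁ x u→x,Cx = let u→x , Cx = ∧-elim u→x,Cx ; x→v = proj₂ (∧-elim Cx) in
      ∧-intro x→v (∧-intro (not-does-intro (x ≟ v) (edge⇒≢ T x→v)) u→x)
    u→C≤ : count (λ x → adj u x ∧ C x) ≤ length direct
    u→C≤ = ≤-trans (count-mono {Q = A₁} u→C⊆A₁) count-A₁≤

  free→stuck : ∀ {x y} → Stuck x ≡ true → Free y ≡ true → Edge T y x
  free→stuck {x} {y} Stuck-x Free-y = nonEdge⇒reverseEdge T (A₂-B-separated A₂x By) x↛y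
    where
    x∉lefts  = proj₁ (Stuck-elim Stuck-x)
    A₂x      = proj₂ (Stuck-elim Stuck-x)
    y∉rights = proj₁ (Free-elim Free-y)
    By       = proj₂ (Free-elim Free-y)
    x↛y : adj x y ≡ false
    x↛y with adj x y in x→y
    ... | false = refl
    ... | true  = contradiction (maximal (∈-allFin x) x∉lefts (∧-intro A₂x (∧-intro x→y By))) y∉rights

  free-outdeg≥ : ∀ {y} → Free y ≡ true → suc (count Stuck + outdegIn T Free y) ≤ count (adj y)
  free-outdeg≥ {y} Free-y = begin
    suc (count Stuck + outdegIn T Free y)
      ≡⟨ cong (_+ (count Stuck + outdegIn T Free y)) y→u ⟨
    𝟙 (adj y u) + (count Stuck + outdegIn T Free y)
      ≤⟨ +-monoʳ-≤ (𝟙 (adj y u)) (count-disjoint Stuck⊆ FreeOut⊆ Stuck∩FreeOut=∅) ⟩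
    𝟙 (adj y u) + count (λ x → not (does (x ≟ u)) ∧ adj y x)
      ≡⟨ count-split-≟ (adj y) u ⟨
    count (adj y) ∎
    where
    open ≤-Reasoning
    By = proj₂ (Free-elim Free-y)
    y→u : 𝟙 (adj y u) ≡ 1
    y→u = cong 𝟙 (nonEdge⇒reverseEdge T (proj₁ (proj₂ (B-elim By)) ∘ sym) (proj₁ (B-elim By)))
    Stuck⊆ : ∀ x → Stuck x ≡ true → not (does (x ≟ u)) ∧ adj y x ≡ true
    Stuck⊆ x Stuck-x = let u→x = proj₁ (A₂-elim (proj₂ (Stuck-elim Stuck-x))) in
      ∧-intro (not-does-intro (x ≟ u) (edge⇒≢ T u→x ∘ sym)) (free→stuck Stuck-x Free-y)
    FreeOut⊆ : ∀ x → Free x ∧ adj y x ≡ true → not (does (x ≟ u)) ∧ adj y x ≡ true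
    FreeOut⊆ x FreeOut = let Free-x , y→x = ∧-elim FreeOut in
      ∧-intro (not-does-intro (x ≟ u) (proj₁ (proj₂ (B-elim (proj₂ (Free-elim Free-x)))))) y→x
    Stuck∩FreeOut=∅ : ∀ x → Stuck x ≡ true → Free x ∧ adj y x ≢ true
    Stuck∩FreeOut=∅ x Stuck-x FreeOut =
      A₂-B-separated (proj₂ (Stuck-elim Stuck-x)) (proj₂ (Free-elim (proj₁ (∧-elim FreeOut)))) refl

  Big Small : Fin n → Bool
  Big   y = does (k ≤? outdegIn T Free y) ∧ Free y
  Small y = not (does (k ≤? outdegIn T Free y)) ∧ Free y

  aboveU aboveV : ℕ
  aboveU = count (λ w → ⌊ outdeg T u <? outdeg T w ⌋)
  aboveV = count (λ w → ⌊ indeg T v <? indeg T w ⌋)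

  count-Big≤ : count Big ≤ aboveU
  count-Big≤ = count-mono {P = Big} {Q = λ w → ⌊ outdeg T u <? outdeg T w ⌋} λ y Big-y →
    let k≤outdegIn , Free-y = ∧-elim Big-y in
    trans (isYes≗does (outdeg T u <? outdeg T y)) (dec-true (outdeg T u <? outdeg T y) (begin-strict
      outdeg T u                         ≡⟨ outdeg≡count T u ⟩
      count (adj u)                      ≤⟨ outdeg-u≤ ⟩
      k + count Stuck                    ≤⟨ +-monoˡ-≤ (count Stuck) (does-elim (k ≤? _) k≤outdegIn) ⟩
      outdegIn T Free y + count Stuck    ≡⟨ +-comm (outdegIn T Free y) (count Stuck) ⟩
      count Stuck + outdegIn T Free y    <⟨ free-outdeg≥ Free-y ⟩
      count (adj y)                      ≡⟨ outdeg≡count T y ⟨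
      outdeg T y                         ∎))
    where open ≤-Reasoning

  count-Small≤ : count Small ≤ 2 * k
  count-Small≤ = outdegIn<⇒count≤ T Small k λ y Small-y → begin-strict
    outdegIn T Small y   ≤⟨ count-mono {P = λ x → Small x ∧ adj y x} (Small⊆Free y) ⟩
    outdegIn T Free y    <⟨ ≰⇒> (not-does-elim (k ≤? _) (proj₁ (∧-elim Small-y))) ⟩
    k                    ∎
    where
    open ≤-Reasoning
    Small⊆Free : ∀ y x → Small x ∧ adj y x ≡ true → Free x ∧ adj y x ≡ true
    Small⊆Free y x SmallOut = let Small-x , y→x = ∧-elim {Small x} SmallOut in
      ∧-intro (proj₂ (∧-elim {not (does (k ≤? outdegIn T Free x))} Small-x)) y→x

  indeg-v-bound : indeg T v ≤ k + (aboveU + 2 * k)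
  indeg-v-bound = begin
    indeg T v                      ≡⟨ ∣tabulate∣≡count (λ x → adj x v) ⟩
    count (λ x → adj x v)          ≤⟨ indeg-v≤ ⟩
    k + count Free                 ≡⟨ cong (k +_) (count-split Free (λ y → does (k ≤? outdegIn T Free y))) ⟩
    k + (count Big + count Small)  ≤⟨ +-monoʳ-≤ k (+-mono-≤ count-Big≤ count-Small≤) ⟩
    k + (aboveU + 2 * k)           ∎
    where open ≤-Reasoning

  vertex-bound : n ≤ aboveV + suc (2 * (k + (aboveU + 2 * k)))
  vertex-bound = begin
    n                                                      ≡⟨ count-complement (λ w → ⌊ indeg T v <? indeg T w ⌋) ⟩
    aboveV + count (λ w → not ⌊ indeg T v <? indeg T w ⌋)  ≤⟨ +-monoʳ-≤ aboveV (∣indeg≤d∣≤1+2d T (indeg T v)) ⟩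
    aboveV + suc (2 * indeg T v)                           ≤⟨ +-monoʳ-≤ aboveV (s≤s (*-monoʳ-≤ 2 indeg-v-bound)) ⟩
    aboveV + suc (2 * (k + (aboveU + 2 * k)))              ∎
    where open ≤-Reasoning

n≤25k : ∀ {n k c₁ c₂} → 2 ≤ n → 25 * c₁ < n → 25 * c₂ < n →
        n ≤ c₂ + suc (2 * (k + (c₁ + 2 * k))) → n ≤ 25 * k
n≤25k {n} {k} {c₁} {c₂} 2≤n 25c₁<n 25c₂<n n≤ with n ≤? 25 * k
... | yes n≤25k = n≤25k
... | no  n≰25k = contradiction (*-cancelˡ-≤ 16 (+-cancelˡ-≤ (9 * n + 9) (16 * n) 16 (begin
  9 * n + 9 + 16 * n                                          ≡⟨ lhs n ⟩
  25 * n + 9                                                  ≤⟨ +-monoˡ-≤ 9 (*-monoʳ-≤ 25 n≤) ⟩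
  25 * (c₂ + suc (2 * (k + (c₁ + 2 * k)))) + 9                ≡⟨ middle c₂ c₁ k ⟩
  suc (25 * c₂) + 2 * suc (25 * c₁) + 6 * suc (25 * k) + 25   ≤⟨ +-monoˡ-≤ 25 (+-mono-≤ (+-mono-≤ 25c₂<n 2*25c₁<2n) 6*25k<6n) ⟩
  n + 2 * n + 6 * n + 25                                      ≡⟨ rhs n ⟩
  9 * n + 9 + 16                                              ∎)))
  (<⇒≱ 2≤n)
  where
  open ≤-Reasoning
  2*25c₁<2n = *-monoʳ-≤ 2 25c₁<n
  6*25k<6n  = *-monoʳ-≤ 6 (≰⇒> n≰25k)
  lhs : ∀ n → 9 * n + 9 + 16 * n ≡ 25 * n + 9
  lhs = solve-∀
  middle : ∀ c₂ c₁ k → 25 * (c₂ + suc (2 * (k + (c₁ + 2 * k)))) + 9 ≡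
                       suc (25 * c₂) + 2 * suc (25 * c₁) + 6 * suc (25 * k) + 25
  middle = solve-∀
  rhs : ∀ n → n + 2 * n + 6 * n + 25 ≡ 9 * n + 9 + 16
  rhs = solve-∀

≢⇒2≤n : ∀ {n} {x y : Fin n} → x ≢ y → 2 ≤ n
≢⇒2≤n {1}           {zero} {zero} x≢y = contradiction refl x≢y
≢⇒2≤n {suc (suc n)}                _   = s≤s (s≤s z≤n)

lemma3p2 : {n : ℕ} (T : Tournament n) (u v : Fin n) → u ≢ v →
    LargeOut T u → LargeIn T v →
    Σ (List (List (Fin n))) (λ ps →
      All (λ mids → IsShortPath T u mids v) ps × InternallyDisjoint ps × n ≤ 25 * length ps)
lemma3p2 {n} T u v u≢v largeOut largeIn =
  paths T u v , paths-short T u v u≢v , paths-internallyDisjoint T u v ,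
  n≤25k {k = k T u v} {c₁ = aboveU T u v} (≢⇒2≤n u≢v)
        (fewer (λ w → ⌊ outdeg T u <? outdeg T w ⌋) largeOut)
        (fewer (λ w → ⌊ indeg T v <? indeg T w ⌋) largeIn)
        (vertex-bound T u v)
  where
  fewer : ∀ P → 25 * ∣ tabulate P ∣ < n → 25 * count P < n
  fewer P = subst (λ c → 25 * c < n) (∣tabulate∣≡count P)
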